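{- Let $N$ be an RPN. If $N$ is tree-based, then its compression $\bar N$ is also tree-based.
   Context: An RPN over a finite set $X$ of taxa is a finite acyclic directed graph $N$ with a unique node of indegree $0$ (the root, which has outdegree at least $1$), all edges directed away from the root, such that every non-root node has indegree $1$ or outdegree $1$, and the nodes of indegree $1$ and outdegree $0$ (leaves) are bijectively labelled by $X$. A non-leaf node of indegree at least $2$ is a reticulate node; a tree node is the root or a node of indegree $1$ and outdegree at least $2$; a redundant node has indegree $1$ and outdegree $1$. $\mathcal{V}(N),\mathcal{E}(N),\mathcal{T}(N),\mathcal{R}(N),\mathcal{D}(N),\mathcal{L}(N)$ denote the sets of nodes, edges, tree nodes, reticulate nodes, redundant nodes and leaves. An edge $(u,v)$ is a reticulate edge if $v$ is a reticulate node. $N$ is tree-based if there is a set $E$ of $\sum_{v\in\mathcal{R}(N)}(d_{in}(v)-1)$ reticulate edges ($d_{in}$ = indegree) such that $(\mathcal{V}(N),\mathcal{E}(N)\setminus E)$ is a rooted tree whose leaf set equals $\mathcal{L}(N)$. Tree-node components are the connected components of the subgraph induced by $\mathcal{T}(N)$; reticulation components are the connected components of the subgraph induced by $\mathcal{R}(N)$. The compression $\bar N$ of $N$ is the directed graph (an RPN over the same taxa, with node types determined by degrees in $\bar N$) whose node set is the set of all tree-node components and reticulation components (each a single node) together with $\mathcal{D}(N)\cup\mathcal{L}(N)$, and whose edges are: (a) every edge $(u,v)$ of $N$ with $u\in\mathcal{D}(N)$, $v\in\mathcal{D}(N)\cup\mathcal{L}(N)$; (b) $(x,v)$ for a component $x$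 and $v\in\mathcal{D}(N)\cup\mathcal{L}(N)$ such that $N$ has an edge from some node of $x$ to $v$; (c) $(v,y)$ for $v\in\mathcal{D}(N)$ and a component $y$ such that $N$ has an edge from $v$ to some node of $y$; (d) $(x,y)$ for distinct components $x,y$ such that $N$ has an edge from a node of $x$ to a node of $y$. -}

module Defs where

open import Data.Nat using (ℕ; zero; suc; _+_; _∸_; _≤_; _≤?_; _≟_)
open import Data.Fin using (Fin)
open import Data.Bool using (Bool; true; false; if_then_else_; _∧_; not)
open import Data.List using (List; map)
open import Data.Nat.ListAction using (sum)
open import Data.List using () renaming (allFin to allFinL)
open import Data.Product using (Σ; ∃; _×_; _,_)
open import Data.Sum using (_⊎_)
open import Relation.Nullary using (¬_; Dec; does)
open import Relation.Nullary.Decidable using (_×-dec_; ¬?)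
open import Relation.Binary.PropositionalEquality using (_≡_; _≢_)
open import Relation.Binary.Construct.Closure.Transitive using (TransClosure)
open import Relation.Binary.Construct.Closure.ReflexiveTransitive using (Star)
open import Function.Bundles using (_⇔_)
open import Function.Definitions using (Injective; Surjective)

record Graph : Set where
  field
    size : ℕ
    edge : Fin size → Fin size → Bool

module _ (G : Graph) where
  open Graph G

  Node : Set
  Node = Fin size

  Edge : Node → Node → Set
  Edge u v = edge u v ≡ true

  countB : (Node → Bool) → ℕ
  countB p = sum (map (λ u → if p u then 1 else 0) (allFinL size))

  indeg : Node → ℕ
  indeg v = countB (λ u → edge u v)

  outdeg : Node → ℕ
  outdeg u = countB (λ v → edge u v)

  edgeCount : ℕ
  edgeCount = sum (map (λ u → outdeg u) (allFinL size))

  Path : Node → Node → Set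
  Path = TransClosure Edge

  Reach : Node → Node → Set
  Reach = Star Edge

  Acyclic : Set
  Acyclic = ∀ v → ¬ Path v v

  IsRoot : Node → Set
  IsRoot v = indeg v ≡ 0

  IsLeaf : Node → Set
  IsLeaf v = indeg v ≡ 1 × outdeg v ≡ 0

  IsReticulate : Node → Set
  IsReticulate v = ¬ IsLeaf v × 2 ≤ indeg v

  IsTreeNode : Node → Set
  IsTreeNode v = IsRoot v ⊎ (indeg v ≡ 1 × 2 ≤ outdeg v)

  IsRedundant : Node → Set
  IsRedundant v = indeg v ≡ 1 × outdeg v ≡ 1

  isLeaf? : ∀ v → Dec (IsLeaf v)
  isLeaf? v = (indeg v ≟ 1) ×-dec (outdeg v ≟ 0)

  isReticulate? : ∀ v → Dec (IsReticulate v)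
  isReticulate? v = ¬? (isLeaf? v) ×-dec (2 ≤? indeg v)

  reticulationNumber : ℕ
  reticulationNumber =
    sum (map (λ v → if does (isReticulate? v) then indeg v ∸ 1 else 0) (allFinL size))

  -- Rooted phylogenetic network over the taxon set X = Fin k
  record IsRPN (k : ℕ) : Set where
    field
      acyclic      : Acyclic
      root         : Node
      root-indeg   : IsRoot root
      root-unique  : ∀ v → IsRoot v → v ≡ root
      root-outdeg  : 1 ≤ outdeg root
      -- all edges directed away from the root: every node is reachable from it
      root-reaches : ∀ v → Reach root v
      nonroot-deg  : ∀ v → v ≢ root → indeg v ≡ 1 ⊎ outdeg v ≡ 1
      label        : Fin k → Node
      label-inj    : Injective _≡_ _≡_ label
      label-leaves : ∀ v → IsLeaf v ⇔ (∃ λ x → label x ≡ v)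

  -- Tree-node components / reticulation components:
  -- connected components of the subgraphs induced by T(G) / R(G).
  TreeAdj : Node → Node → Set
  TreeAdj u v = IsTreeNode u × IsTreeNode v × (Edge u v ⊎ Edge v u)

  SameTreeComponent : Node → Node → Set
  SameTreeComponent u v = IsTreeNode u × IsTreeNode v × Star TreeAdj u v

  RetAdj : Node → Node → Set
  RetAdj u v = IsReticulate u × IsReticulate v × (Edge u v ⊎ Edge v u)

  SameRetComponent : Node → Node → Set
  SameRetComponent u v = IsReticulate u × IsReticulate v × Star RetAdj u v

removeEdges : (G : Graph) → (Fin (Graph.size G) → Fin (Graph.size G) → Bool) → Graph
removeEdges G S = record { size = Graph.size G ; edge = λ u v → Graph.edge G u v ∧ not (S u v) }

IsRootedTree : Graph → Set
IsRootedTree T =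
  Acyclic T × Σ (Node T) λ r → IsRoot T r × (∀ v → v ≢ r → indeg T v ≡ 1) × (∀ v → Reach T r v)

TreeBased : Graph → Set
TreeBased G =
  Σ (Node G → Node G → Bool) λ S →
      (∀ u v → S u v ≡ true → Edge G u v × IsReticulate G v)
    × edgeCount (record { size = Graph.size G ; edge = S }) ≡ reticulationNumber G
    × IsRootedTree (removeEdges G S)
    × (∀ v → IsLeaf (removeEdges G S) v ⇔ IsLeaf G v)

-- C (with quotient map φ) is the compression of N: φ identifies exactly the
-- nodes lying in a common tree-node component or a common reticulation
-- component (redundant nodes and leaves stay alone), and C has an edge x → y
-- iff x ≠ y and N has an edge from a node of x to a node of y.
record IsCompression (N C : Graph) (φ : Node N → Node C) : Set where
  field
    φ-surj  : Surjective _≡_ _≡_ φ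
    φ-ident : ∀ u v → (φ u ≡ φ v) ⇔ (u ≡ v ⊎ SameTreeComponent N u v ⊎ SameRetComponent N u v)
    edges   : ∀ x y → Edge C x y ⇔
                (x ≢ y × ∃ λ u → ∃ λ v → φ u ≡ x × φ v ≡ y × Edge N u v)

module Submission where

-- Let T be a base tree of N (N minus a set of reticulate edges) and let
-- φ : N → C be the compression map.  Edges of N into non-reticulate nodes and
-- edges out of reticulate nodes all survive in T, so every class φ⁻¹(x) is
-- connected by T-edges.  Since T-parents are unique, a T-connected class has
-- exactly one "entry" (the root of N, or a node whose T-parent lies outside
-- the class), and the whole class hangs below it.  Hence for each class x
-- other than φ(root) there is exactly one class a from which a T-edge enters
-- x (a "crossing" a → x).  The base tree of C keeps precisely the C-edges
-- a → x that are crossings: it has one in-edge at every non-root class, it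
-- is acyclic because crossings move strictly down T between entries, and
-- only reticulate classes lose in-edges (exactly indeg − 1 of them).

open import Defs
open import Data.Nat using (ℕ; zero; suc; _+_; _∸_; _≤_; _<_; z≤n; s≤s)
open import Data.Nat.Properties using (+-0-commutativeMonoid; +-suc; m+n∸m≡n; n<1+n; m≤n⇒m<n∨m≡n; 0≢1+n)
open import Data.Nat.ListAction using () renaming (sum to listSum)
open import Data.Fin using (Fin; toℕ) renaming (zero to fzero; suc to fsuc; _≟_ to _≟ᶠ_)
open import Data.Fin.Properties using (pigeonhole; any?; suc-injective) renaming (0≢1+n to fzero≢fsuc)
open import Data.Bool using (Bool; true; false; if_then_else_; _∧_; not) renaming (_≟_ to _≟ᵇ_)
open import Data.Bool.Properties using (∧-conicalˡ; ∧-conicalʳ)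
open import Data.List using (map; tabulate; allFin)
open import Data.List.Properties using (map-tabulate)
open import Data.Product using (∃; _×_; _,_; proj₁; proj₂)
open import Data.Sum using (_⊎_; inj₁; inj₂) renaming (map to ⊎-map)
open import Data.Empty using (⊥; ⊥-elim)
open import Function.Base using (_∘_; id)
open import Function.Bundles using (_⇔_; mk⇔; Equivalence)
open import Relation.Nullary using (¬_; Dec; yes; no; does)
open import Relation.Nullary.Decidable using (dec-true; _×-dec_; ¬?)
open import Relation.Binary.PropositionalEquality using (_≡_; _≢_; refl; sym; trans; cong; cong₂; subst; module ≡-Reasoning)
open import Relation.Binary.Construct.Closure.Transitive using (TransClosure; [_]; _∷_; _∷ʳ_) renaming (_++_ to _++⁺_)
open import Relation.Binary.Construct.Closure.ReflexiveTransitive as Star using (Star; ε; _◅_; _◅◅_)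
open import Algebra.Properties.CommutativeMonoid.Sum +-0-commutativeMonoid using (sum-cong-≗; ∑-comm) renaming (sum to ∑)

open Equivalence using (to; from)

¬1≤0 : ∀ {n} → n ≡ 0 → ¬ 1 ≤ n
¬1≤0 refl ()

¬2≤0 : ∀ {n} → n ≡ 0 → ¬ 2 ≤ n
¬2≤0 refl ()

¬2≤1 : ∀ {n} → n ≡ 1 → ¬ 2 ≤ n
¬2≤1 refl (s≤s ())

kept-edges : ∀ e c → e ∧ not (e ∧ not c) ≡ e ∧ c
kept-edges true  true  = refl
kept-edges true  false = refl
kept-edges false _     = refl

not-true : ∀ {b} → not b ≡ true → b ≢ true
not-true {false} _ ()

from-does : ∀ {P : Set} (d : Dec P) → does d ≡ true → P
from-does (yes p) _ = p

bit : Bool → ℕ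
bit b = if b then 1 else 0

count : ∀ {n} → (Fin n → Bool) → ℕ
count p = ∑ (λ i → bit (p i))

listSum-allFin : ∀ n (f : Fin n → ℕ) → listSum (map f (allFin n)) ≡ ∑ f
listSum-allFin n f = trans (cong listSum (map-tabulate id f)) (listSum-tabulate f)
  where
  listSum-tabulate : ∀ {m} (g : Fin m → ℕ) → listSum (tabulate g) ≡ ∑ g
  listSum-tabulate {zero}  g = refl
  listSum-tabulate {suc m} g = cong (g fzero +_) (listSum-tabulate (g ∘ fsuc))

countB≡count : ∀ G (p : Node G → Bool) → countB G p ≡ count p
countB≡count G p = listSum-allFin (Graph.size G) (λ u → bit (p u))

count-none : ∀ {n} (p : Fin n → Bool) → (∀ i → p i ≢ true) → count p ≡ 0
count-none {zero}  p none = refl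
count-none {suc n} p none with p fzero in eq
... | true  = ⊥-elim (none fzero eq)
... | false = count-none (p ∘ fsuc) (none ∘ fsuc)

count-pos : ∀ {n} (p : Fin n → Bool) i → p i ≡ true → 1 ≤ count p
count-pos p fzero    e rewrite e = s≤s z≤n
count-pos p (fsuc i) e with p fzero
... | true  = s≤s z≤n
... | false = count-pos (p ∘ fsuc) i e

count-witness : ∀ {n} (p : Fin n → Bool) → 1 ≤ count p → ∃ λ i → p i ≡ true
count-witness {zero}  p ()
count-witness {suc n} p pos with p fzero in eq
... | true  = fzero , eq
... | false = let (i , e) = count-witness (p ∘ fsuc) pos in fsuc i , e

count-two : ∀ {n} (p : Fin n → Bool) {i j} → p i ≡ true → p j ≡ true → i ≢ j → 2 ≤ count p
count-two p {fzero}  {fzero}  _  _  i≢j = ⊥-elim (i≢j refl)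
count-two p {fzero}  {fsuc j} ei ej _ rewrite ei = s≤s (count-pos (p ∘ fsuc) j ej)
count-two p {fsuc i} {fzero}  ei ej _ rewrite ej = s≤s (count-pos (p ∘ fsuc) i ei)
count-two p {fsuc i} {fsuc j} ei ej i≢j with p fzero
... | true  = s≤s (count-pos (p ∘ fsuc) i ei)
... | false = count-two (p ∘ fsuc) ei ej (i≢j ∘ cong fsuc)

count-one : ∀ {n} (p : Fin n → Bool) i → p i ≡ true → (∀ j → p j ≡ true → j ≡ i) → count p ≡ 1
count-one p fzero e only rewrite e =
  cong suc (count-none (p ∘ fsuc) (λ j ej → fzero≢fsuc (sym (only (fsuc j) ej))))
count-one p (fsuc i) e only with p fzero in eq
... | true  = ⊥-elim (fzero≢fsuc (only fzero eq))
... | false = count-one (p ∘ fsuc) i e (λ j ej → suc-injective (only (fsuc j) ej))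

count-split : ∀ {n} (p q : Fin n → Bool) →
              count p ≡ count (λ i → p i ∧ q i) + count (λ i → p i ∧ not (q i))
count-split {zero}  p q = refl
count-split {suc n} p q with p fzero | q fzero | count-split (p ∘ fsuc) (q ∘ fsuc)
... | true  | true  | ih = cong suc ih
... | true  | false | ih = trans (cong suc ih) (sym (+-suc _ _))
... | false | _     | ih = ih

module Degrees (G : Graph) where
  open Graph G using (edge)

  parentless : ∀ {u v} → indeg G v ≡ 0 → ¬ Edge G u v
  parentless {u} {v} h e = ¬1≤0 (trans (sym (countB≡count G _)) h) (count-pos (λ a → edge a v) u e)

  childless : ∀ {u v} → outdeg G u ≡ 0 → ¬ Edge G u v
  childless {u} {v} h e = ¬1≤0 (trans (sym (countB≡count G _)) h) (count-pos (λ b → edge u b) v e)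

  indeg≡0 : ∀ {v} → (∀ u → ¬ Edge G u v) → indeg G v ≡ 0
  indeg≡0 none = trans (countB≡count G _) (count-none _ none)

  outdeg≡0 : ∀ {u} → (∀ v → ¬ Edge G u v) → outdeg G u ≡ 0
  outdeg≡0 none = trans (countB≡count G _) (count-none _ none)

  indeg≡1 : ∀ {a v} → Edge G a v → (∀ b → Edge G b v → b ≡ a) → indeg G v ≡ 1
  indeg≡1 {a} e only = trans (countB≡count G _) (count-one _ a e only)

  some-child : ∀ {u} → 1 ≤ outdeg G u → ∃ λ v → Edge G u v
  some-child pos = count-witness _ (subst (1 ≤_) (countB≡count G _) pos)

  two-parents : ∀ {a b v} → Edge G a v → Edge G b v → a ≢ b → 2 ≤ indeg G v
  two-parents ea eb a≢b = subst (2 ≤_) (sym (countB≡count G _)) (count-two _ ea eb a≢b)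

  unique-parent : ∀ {a b v} → indeg G v ≡ 1 → Edge G a v → Edge G b v → a ≡ b
  unique-parent {a} {b} one ea eb with a ≟ᶠ b
  ... | yes a≡b = a≡b
  ... | no  a≢b = ⊥-elim (¬2≤1 one (two-parents ea eb a≢b))

  unique-child : ∀ {u a b} → outdeg G u ≡ 1 → Edge G u a → Edge G u b → a ≡ b
  unique-child {u} {a} {b} one ea eb with a ≟ᶠ b
  ... | yes a≡b = a≡b
  ... | no  a≢b = ⊥-elim (¬2≤1 one (subst (2 ≤_) (sym (countB≡count G _)) (count-two _ ea eb a≢b)))

  -- A node with two distinct parents is reticulate (a leaf has only one).
  two-parents⇒reticulate : ∀ {a b v} → Edge G a v → Edge G b v → a ≢ b → IsReticulate G v
  two-parents⇒reticulate ea eb a≢b = (λ leaf → ¬2≤1 (proj₁ leaf) two) , two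
    where two = two-parents ea eb a≢b

  tree-node-not-reticulate : ∀ {v} → IsTreeNode G v → ¬ IsReticulate G v
  tree-node-not-reticulate (inj₁ in0)       (_ , two) = ¬2≤0 in0 two
  tree-node-not-reticulate (inj₂ (in1 , _)) (_ , two) = ¬2≤1 in1 two

  tree-node-not-leaf : ∀ {v} → IsTreeNode G v → ¬ IsLeaf G v
  tree-node-not-leaf (inj₁ in0)        (in1 , _)  = 0≢1+n (trans (sym in0) in1)
  tree-node-not-leaf (inj₂ (_ , two)) (_ , out0) = ¬2≤0 out0 two

module _ {A : Set} {R : A → A → Set} where

  last-step : ∀ {x y} → Star R x y → x ≡ y ⊎ ∃ λ p → Star R x p × R p y
  last-step ε = inj₁ refl
  last-step (r ◅ rs) with last-step rs
  ... | inj₁ refl           = inj₂ (_ , ε , r)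
  ... | inj₂ (p , rs′ , r′) = inj₂ (p , r ◅ rs′ , r′)

  first-step : ∀ {x y} → Star R x y → x ≢ y → ∃ λ z → R x z
  first-step ε       x≢x = ⊥-elim (x≢x refl)
  first-step (r ◅ _) _   = _ , r

  _◅◅ʳ_ : ∀ {x y z} → Star R x y → R y z → TransClosure R x z
  ε        ◅◅ʳ r = [ r ]
  (q ◅ rs) ◅◅ʳ r = q ∷ (rs ◅◅ʳ r)

-- Let R have unique predecessors and let s be a "top"
-- of a set P: s ∈ P but no predecessor of s is in P.  Then a walk from s
-- along R-edges in either direction that cannot leave P only goes down: it
-- ends at a node reachable from s by an R-path inside P.  (Going back up an
-- edge retraces the last step of that path, by uniqueness of predecessors.)
module ForestDescent {A : Set} (R : A → A → Set)
                     (parent-unique : ∀ {p q w} → R p w → R q w → p ≡ q) where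

  Inside : (A → Set) → A → A → Set
  Inside P a b = R a b × P a × P b

  Zigzag : (A → Set) → A → A → Set
  Zigzag P a b = (P a → P b) × (R a b ⊎ R b a)

  Top : (A → Set) → A → Set
  Top P s = P s × (∀ p → R p s → ¬ P p)

  descend : ∀ {P s w} → Top P s → Star (Zigzag P) s w → Star (Inside P) s w
  descend {P} {s} (s∈P , top) = go ε s∈P
    where
    go : ∀ {a w} → Star (Inside P) s a → P a → Star (Zigzag P) a w → Star (Inside P) s w
    go acc a∈P ε = acc
    go acc a∈P ((stay , inj₁ down) ◅ z) = go (acc ◅◅ ((down , a∈P , stay a∈P) ◅ ε)) (stay a∈P) z
    go acc a∈P ((stay , inj₂ up) ◅ z) with last-step acc
    ... | inj₁ refl = ⊥-elim (top _ up (stay a∈P))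
    ... | inj₂ (p , acc′ , (down , p∈P , _)) with refl ← parent-unique down up = go acc′ p∈P z

  outside-parent⇒top : ∀ {P s u v} → Top P s → Star (Zigzag P) s v → R u v → ¬ P u → s ≡ v
  outside-parent⇒top {P} t z e u∉P with last-step (descend t z)
  ... | inj₁ s≡v = s≡v
  ... | inj₂ (p , _ , (e′ , p∈P , _)) = ⊥-elim (u∉P (subst P (parent-unique e′ e) p∈P))

-- In a finite acyclic relation no inhabited set is closed under successors:
-- following successors n + 1 times repeats a node (pigeonhole), closing a cycle.
no-successor-closed-set : ∀ {n} (R : Fin n → Fin n → Set) → (∀ v → ¬ TransClosure R v v) →
                          (P : Fin n → Set) → (∀ w → P w → ∃ λ w′ → R w w′ × P w′) →
                          ∀ s → ¬ P s
no-successor-closed-set {n} R acyclic P next s s∈P =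
  let (i , j , i<j , same) = pigeonhole (n<1+n n) (node ∘ toℕ) in repeat (toℕ i) (toℕ j) i<j same
  where
  node : ℕ → Fin n
  inP  : ∀ m → P (node m)
  node zero    = s
  node (suc m) = proj₁ (next (node m) (inP m))
  inP zero     = s∈P
  inP (suc m)  = proj₂ (proj₂ (next (node m) (inP m)))

  step : ∀ m → R (node m) (node (suc m))
  step m = proj₁ (proj₂ (next (node m) (inP m)))

  path : ∀ i j → i < j → TransClosure R (node i) (node j)
  path i (suc j) (s≤s i≤j) with m≤n⇒m<n∨m≡n i≤j
  ... | inj₁ i<j  = path i j i<j ∷ʳ step j
  ... | inj₂ refl = [ step i ]

  repeat : ∀ i j → i < j → node i ≡ node j → ⊥
  repeat i j i<j same = acyclic (node i) (subst (TransClosure R (node i)) (sym same) (path i j i<j))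

module SpanningTree
  (N : Graph) {k : ℕ} (rpn : IsRPN N k)
  (S : Node N → Node N → Bool)
  (S-reticulate : ∀ u v → S u v ≡ true → Edge N u v × IsReticulate N v)
  (T-acyclic : Acyclic (removeEdges N S))
  (r : Node N)
  (T-nonroot : ∀ v → v ≢ r → indeg (removeEdges N S) v ≡ 1)
  (T-reaches-from-r : ∀ v → Reach (removeEdges N S) r v)
  (T-leaves : ∀ v → IsLeaf (removeEdges N S) v ⇔ IsLeaf N v) where

  open IsRPN rpn
  module DN = Degrees N

  T : Graph
  T = removeEdges N S

  module DT = Degrees T

  T⊆N : ∀ {u v} → Edge T u v → Edge N u v
  T⊆N {u} {v} = ∧-conicalˡ (Graph.edge N u v) _

  root-parentless : ∀ {u} → ¬ Edge N u root
  root-parentless = DN.parentless root-indeg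

  root-not-reticulate : ¬ IsReticulate N root
  root-not-reticulate = DN.tree-node-not-reticulate (inj₁ root-indeg)

  -- The root of T is the root of N, as the latter has no parent.
  r≡root : r ≡ root
  r≡root with last-step (T-reaches-from-r root)
  ... | inj₁ r≡root      = r≡root
  ... | inj₂ (_ , _ , e) = ⊥-elim (root-parentless (T⊆N e))

  T-reaches : ∀ v → Reach T root v
  T-reaches v = subst (λ x → Reach T x v) r≡root (T-reaches-from-r v)

  T-parent-unique : ∀ {p q w} → Edge T p w → Edge T q w → p ≡ q
  T-parent-unique {w = w} ep eq with w ≟ᶠ root
  ... | yes refl   = ⊥-elim (root-parentless (T⊆N ep))
  ... | no  w≢root = DT.unique-parent (T-nonroot w (λ w≡r → w≢root (trans w≡r r≡root))) ep eq

  -- Only reticulate edges were removed.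
  kept-into-nonreticulate : ∀ {u v} → Edge N u v → ¬ IsReticulate N v → Edge T u v
  kept-into-nonreticulate {u} {v} e ¬ret with S u v in removed
  ... | true  = ⊥-elim (¬ret (proj₂ (S-reticulate u v removed)))
  ... | false rewrite e = refl

  -- A reticulate node u has a single child in N.  Were that edge removed, u
  -- would be a leaf of T, hence of N, which a reticulate node is not.
  kept-out-of-reticulate : ∀ {u v} → Edge N u v → IsReticulate N u → Edge T u v
  kept-out-of-reticulate {u} {v} e ret@(¬leaf , two) with Graph.edge T u v in kept
  ... | true  = refl
  ... | false = ⊥-elim (¬leaf (to (T-leaves u) (T-indeg-one , T-outdeg-zero)))
    where
    u≢root : u ≢ root
    u≢root refl = root-not-reticulate ret

    N-outdeg-one : outdeg N u ≡ 1
    N-outdeg-one with nonroot-deg u u≢root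
    ... | inj₁ in1  = ⊥-elim (¬2≤1 in1 two)
    ... | inj₂ out1 = out1

    T-indeg-one : indeg T u ≡ 1
    T-indeg-one = T-nonroot u (λ u≡r → u≢root (trans u≡r r≡root))

    T-outdeg-zero : outdeg T u ≡ 0
    T-outdeg-zero = DT.outdeg≡0 λ w ew →
      not-true (cong not kept) (subst (λ x → Graph.edge T u x ≡ true) (DN.unique-child N-outdeg-one (T⊆N ew) e) ew)

  -- Every non-leaf of N has a child in T: the root because it has a
  -- descendant, any other node because otherwise it would be a leaf of T.
  T-child : ∀ {w} → ¬ IsLeaf N w → ∃ λ w′ → Edge T w w′
  T-child {w} ¬leaf with any? (λ w′ → Graph.edge T w w′ ≟ᵇ true)
  ... | yes child = child
  ... | no  none with w ≟ᶠ root
  ...   | yes refl =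
            let (v , e) = DN.some-child root-outdeg
            in first-step (T-reaches v) (λ root≡v → root-parentless (subst (Edge N root) (sym root≡v) e))
  ...   | no  w≢root =
            ⊥-elim (¬leaf (to (T-leaves w) ( T-nonroot w (λ w≡r → w≢root (trans w≡r r≡root))
                                            , DT.outdeg≡0 (λ w′ e → none (w′ , e)))))

  module Classes (C : Graph) (φ : Node N → Node C) (compression : IsCompression N C φ) where
    open IsCompression compression
    open ForestDescent (Edge T) T-parent-unique
    module DC = Degrees C

    representative : ∀ x → ∃ λ w → φ w ≡ x
    representative x = let (w , hit) = φ-surj x in w , hit refl

    InClass : Node C → Node N → Set
    InClass x w = φ w ≡ x

    ClassLink : Node N → Node N → Set
    ClassLink a b = φ a ≡ φ b × (Edge T a b ⊎ Edge T b a)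

    tree-link : ∀ {a b} → TreeAdj N a b → ClassLink a b
    tree-link {a} {b} adj@(ta , tb , e) =
      from (φ-ident a b) (inj₂ (inj₁ (ta , tb , adj ◅ ε))) ,
      ⊎-map (λ e → kept-into-nonreticulate e (DN.tree-node-not-reticulate tb))
            (λ e → kept-into-nonreticulate e (DN.tree-node-not-reticulate ta)) e

    ret-link : ∀ {a b} → RetAdj N a b → ClassLink a b
    ret-link {a} {b} adj@(ra , rb , e) =
      from (φ-ident a b) (inj₂ (inj₂ (ra , rb , adj ◅ ε))) ,
      ⊎-map (λ e → kept-out-of-reticulate e ra) (λ e → kept-out-of-reticulate e rb) e

    class-walk : ∀ {a b} → φ a ≡ φ b → Star ClassLink a b
    class-walk {a} {b} same with to (φ-ident a b) same
    ... | inj₁ refl               = ε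
    ... | inj₂ (inj₁ (_ , _ , s)) = Star.map tree-link s
    ... | inj₂ (inj₂ (_ , _ , s)) = Star.map ret-link s

    class-zigzag : ∀ {x a b} → Star ClassLink a b → Star (Zigzag (InClass x)) a b
    class-zigzag = Star.map (λ (same , e) → (λ a∈x → trans (sym same) a∈x) , e)

    Entry : Node C → Node N → Set
    Entry x v = φ v ≡ x × (v ≡ root ⊎ ∃ λ u → Edge T u v × φ u ≢ x)

    entry-top : ∀ {x v} → Entry x v → Top (InClass x) v
    entry-top (v∈x , inj₁ refl)          = v∈x , λ p e _ → root-parentless (T⊆N e)
    entry-top (v∈x , inj₂ (u , e , u∉x)) =
      v∈x , λ p e′ p∈x → u∉x (subst (InClass _) (T-parent-unique e′ e) p∈x)

    entry-is-top : ∀ {x v u v′} → Entry x v → φ v′ ≡ x → Edge T u v′ → φ u ≢ x → v ≡ v′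
    entry-is-top E v′∈x e u∉x =
      outside-parent⇒top (entry-top E) (class-zigzag (class-walk (trans (proj₁ E) (sym v′∈x)))) e u∉x

    entry-unique : ∀ {x v v′} → Entry x v → Entry x v′ → v ≡ v′
    entry-unique E                   (v′∈x , inj₂ (_ , e′ , u′∉x)) = entry-is-top E v′∈x e′ u′∉x
    entry-unique (v∈x , inj₂ (_ , e , u∉x)) E′@(_ , inj₁ _)         = sym (entry-is-top E′ v∈x e u∉x)
    entry-unique (_ , inj₁ v≡root)   (_ , inj₁ v′≡root)             = trans v≡root (sym v′≡root)

    -- Every node lies below the entry of its class: walk down T from the
    -- root, updating the entry whenever the walk changes class.
    entry-above : ∀ w → ∃ λ e → Entry (φ w) e × Reach T e w
    entry-above w = go (refl , inj₁ refl) ε (T-reaches w)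
      where
      go : ∀ {a e w} → Entry (φ a) e → Reach T e a → Reach T a w → ∃ λ e′ → Entry (φ w) e′ × Reach T e′ w
      go E down ε = _ , E , down
      go {a} E down (_◅_ {j = b} t rest) with φ b ≟ᶠ φ a
      ... | yes same   = go (subst (λ x → Entry x _) (sym same) E) (down ◅◅ (t ◅ ε)) rest
      ... | no  differ = go (refl , inj₂ (a , t , differ ∘ sym)) ε rest

    root-class-nonreticulate : ∀ {v} → φ v ≡ φ root → ¬ IsReticulate N v
    root-class-nonreticulate {v} same with to (φ-ident v root) same
    ... | inj₁ refl                   = root-not-reticulate
    ... | inj₂ (inj₁ (tv , _ , _))    = DN.tree-node-not-reticulate tv
    ... | inj₂ (inj₂ (_ , ret , _))   = ⊥-elim (root-not-reticulate ret)

    -- No N-edge enters the class of the root from outside: its head would be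
    -- a second entry of that class besides the root.
    root-class-closed : ∀ {u v} → Edge N u v → φ v ≡ φ root → φ u ≡ φ root
    root-class-closed {u} {v} e v∈root with φ u ≟ᶠ φ root
    ... | yes u∈root = u∈root
    ... | no  u∉root = ⊥-elim (root-parentless (subst (Edge N u) v≡root e))
      where
      v≡root : v ≡ root
      v≡root = entry-unique (v∈root , inj₂ (u , kept-into-nonreticulate e (root-class-nonreticulate v∈root) , u∉root))
                            (refl , inj₁ refl)

    -- A leaf is neither a tree node nor reticulate, so it is alone in its class.
    leaf-class-singleton : ∀ {ℓ u} → IsLeaf N ℓ → φ u ≡ φ ℓ → u ≡ ℓ
    leaf-class-singleton {ℓ} {u} leaf same with to (φ-ident u ℓ) same
    ... | inj₁ u≡ℓ                   = u≡ℓ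
    ... | inj₂ (inj₁ (_ , tℓ , _))   = ⊥-elim (DN.tree-node-not-leaf tℓ leaf)
    ... | inj₂ (inj₂ (_ , rℓ , _))   = ⊥-elim (proj₁ rℓ leaf)

    -- A class other than a leaf is left by some T-edge; otherwise it would be
    -- closed under T-children (its nodes are not leaves), contradicting the
    -- acyclicity of the finite tree T.
    class-exit : ∀ {u} → ¬ IsLeaf N u → ∃ λ w → ∃ λ w′ → φ w ≡ φ u × φ w′ ≢ φ u × Edge T w w′
    class-exit {u} ¬leaf
      with any? (λ w → any? (λ w′ → (φ w ≟ᶠ φ u) ×-dec ¬? (φ w′ ≟ᶠ φ u) ×-dec (Graph.edge T w w′ ≟ᵇ true)))
    ... | yes exit = exit
    ... | no  none = ⊥-elim (no-successor-closed-set (Edge T) T-acyclic (InClass (φ u)) stays u refl)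
      where
      stays : ∀ w → φ w ≡ φ u → ∃ λ w′ → Edge T w w′ × φ w′ ≡ φ u
      stays w w∈u with T-child (λ w-leaf → ¬leaf (subst (IsLeaf N) (sym (leaf-class-singleton w-leaf (sym w∈u))) w-leaf))
      ... | w′ , e with φ w′ ≟ᶠ φ u
      ... | yes w′∈u = w′ , e , w′∈u
      ... | no  w′∉u = ⊥-elim (none (w , w′ , w∈u , w′∉u , e))

    Crossing : Node C → Node C → Set
    Crossing a x = a ≢ x × ∃ λ u → ∃ λ v → φ u ≡ a × φ v ≡ x × Edge T u v

    crossing? : ∀ a x → Dec (Crossing a x)
    crossing? a x =
      ¬? (a ≟ᶠ x) ×-dec any? (λ u → any? (λ v → (φ u ≟ᶠ a) ×-dec (φ v ≟ᶠ x) ×-dec (Graph.edge T u v ≟ᵇ true)))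

    crossing⇒edge : ∀ {a x} → Crossing a x → Edge C a x
    crossing⇒edge (a≢x , u , v , refl , refl , e) = from (edges _ _) (a≢x , u , v , refl , refl , T⊆N e)

    -- A crossing into x ends at the unique entry of x, so it starts at the
    -- class of that entry's unique T-parent.
    crossing-unique : ∀ {a b x} → Crossing a x → Crossing b x → a ≡ b
    crossing-unique (a≢x , u , v , refl , refl , e) (b≢x , u′ , v′ , refl , v′∈x , e′) =
      cong φ (T-parent-unique e (subst (Edge T u′) (sym v≡v′) e′))
      where
      v≡v′ = entry-unique (refl , inj₂ (u , e , a≢x)) (v′∈x , inj₂ (u′ , e′ , b≢x))

    -- The entry of a class other than the root's has a T-parent outside it.
    crossing-into : ∀ x → x ≢ φ root → ∃ λ a → Crossing a x
    crossing-into x x≢root with representative x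
    ... | w , refl with entry-above w
    ... | e , (e∈w , inj₁ refl) , _         = ⊥-elim (x≢root (sym e∈w))
    ... | e , (e∈w , inj₂ (u , t , u∉w)) , _ = φ u , u∉w , u , e , refl , e∈w , t

    no-edge-into-root-class : ∀ {a} → ¬ Edge C a (φ root)
    no-edge-into-root-class e with to (edges _ _) e
    ... | a≢root , u , v , refl , v∈root , ev = a≢root (root-class-closed ev v∈root)

    root-class-indeg : indeg C (φ root) ≡ 0
    root-class-indeg = DC.indeg≡0 (λ _ → no-edge-into-root-class)

    -- A non-reticulate class has a single in-neighbour in C, which must be
    -- the source of the crossing entering it.
    nonreticulate-edge-crosses : ∀ {a x} → ¬ IsReticulate C x → Edge C a x → Crossing a x
    nonreticulate-edge-crosses {a} {x} ¬ret e with crossing-into x (λ { refl → no-edge-into-root-class e })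
    ... | b , cross with a ≟ᶠ b
    ... | yes refl = cross
    ... | no  a≢b  = ⊥-elim (¬ret (DC.two-parents⇒reticulate e (crossing⇒edge cross) a≢b))

    S̄ : Node C → Node C → Bool
    S̄ a x = Graph.edge C a x ∧ not (does (crossing? a x))

    C̄ : Graph
    C̄ = removeEdges C S̄

    module DC̄ = Degrees C̄

    kept⇒crossing : ∀ {a x} → Edge C̄ a x → Crossing a x
    kept⇒crossing {a} {x} k =
      from-does (crossing? a x) (∧-conicalʳ (Graph.edge C a x) _ (trans (sym (kept-edges (Graph.edge C a x) (does (crossing? a x)))) k))

    crossing⇒kept : ∀ {a x} → Crossing a x → Edge C̄ a x
    crossing⇒kept {a} {x} c rewrite crossing⇒edge c | dec-true (crossing? a x) c = refl

    dropped-not-crossing : ∀ {a x} → S̄ a x ≡ true → ¬ Crossing a x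
    dropped-not-crossing {a} {x} h c = not-true (∧-conicalʳ _ _ h) (dec-true (crossing? a x) c)

    S̄-reticulate : ∀ a x → S̄ a x ≡ true → Edge C a x × IsReticulate C x
    S̄-reticulate a x h with isReticulate? C x
    ... | yes ret  = ∧-conicalˡ _ _ h , ret
    ... | no  ¬ret = ⊥-elim (dropped-not-crossing h (nonreticulate-edge-crosses ¬ret (∧-conicalˡ _ _ h)))

    dropped-into : ∀ v (ret? : Dec (IsReticulate C v)) →
                   count (λ u → S̄ u v) ≡ (if does ret? then indeg C v ∸ 1 else 0)
    dropped-into v (no ¬ret) = count-none (λ u → S̄ u v) (λ u h → dropped-not-crossing {u} {v} h (nonreticulate-edge-crosses ¬ret (∧-conicalˡ _ _ h)))
    dropped-into v (yes ret) = begin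
      count (λ u → S̄ u v)                                           ≡⟨ sym (m+n∸m≡n 1 (count (λ u → S̄ u v))) ⟩
      1 + count (λ u → S̄ u v) ∸ 1                                   ≡⟨ cong (λ n → n + count (λ u → S̄ u v) ∸ 1) (sym kept-one) ⟩
      count (λ u → Graph.edge C u v ∧ does (crossing? u v)) + count (λ u → S̄ u v) ∸ 1
                                                                     ≡⟨ cong (_∸ 1) (sym (count-split (λ u → Graph.edge C u v) (λ u → does (crossing? u v)))) ⟩
      count (λ u → Graph.edge C u v) ∸ 1                            ≡⟨ cong (_∸ 1) (sym (countB≡count C (λ u → Graph.edge C u v))) ⟩
      indeg C v ∸ 1                                                  ∎
      where
      open ≡-Reasoning
      v≢root : v ≢ φ root
      v≢root refl = ¬2≤0 root-class-indeg (proj₂ ret)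

      kept-one : count (λ u → Graph.edge C u v ∧ does (crossing? u v)) ≡ 1
      kept-one with crossing-into v v≢root
      ... | a , c = count-one (λ u → Graph.edge C u v ∧ does (crossing? u v)) a (cong₂ _∧_ (crossing⇒edge c) (dec-true (crossing? a v) c))
                      (λ b h → crossing-unique (from-does (crossing? b v) (∧-conicalʳ (Graph.edge C b v) _ h)) c)

    -- Counting dropped edges by their heads gives Σ_{x ∈ R(C)} (indeg x − 1).
    S̄-count : edgeCount (record { size = Graph.size C ; edge = S̄ }) ≡ reticulationNumber C
    S̄-count = begin
      edgeCount (record { size = Graph.size C ; edge = S̄ })          ≡⟨ listSum-allFin (Graph.size C) (λ u → countB (record { size = Graph.size C ; edge = S̄ }) (S̄ u)) ⟩
      ∑ (λ u → countB (record { size = Graph.size C ; edge = S̄ }) (S̄ u))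
                                                                      ≡⟨ sum-cong-≗ (λ u → countB≡count C (S̄ u)) ⟩
      ∑ (λ u → ∑ (λ v → bit (S̄ u v)))                                ≡⟨ ∑-comm (λ u v → bit (S̄ u v)) ⟩
      ∑ (λ v → count (λ u → S̄ u v))                                  ≡⟨ sum-cong-≗ (λ v → dropped-into v (isReticulate? C v)) ⟩
      ∑ (λ v → if does (isReticulate? C v) then indeg C v ∸ 1 else 0) ≡⟨ sym (listSum-allFin (Graph.size C) (λ v → if does (isReticulate? C v) then indeg C v ∸ 1 else 0)) ⟩
      reticulationNumber C                                            ∎
      where open ≡-Reasoning

    -- C̄ is a rooted tree: the root class has no in-edge and every other class
    -- exactly one, namely its unique crossing.
    C̄-root-indeg : indeg C̄ (φ root) ≡ 0
    C̄-root-indeg = DC̄.indeg≡0 (λ a k → no-edge-into-root-class (crossing⇒edge (kept⇒crossing k)))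

    C̄-nonroot-indeg : ∀ x → x ≢ φ root → indeg C̄ x ≡ 1
    C̄-nonroot-indeg x x≢root with crossing-into x x≢root
    ... | a , c = DC̄.indeg≡1 (crossing⇒kept c) (λ b k → crossing-unique (kept⇒crossing k) c)

    -- T-paths project to C̄-paths: each class change along T is a crossing.
    project : ∀ {a b} → Reach T a b → Reach C̄ (φ a) (φ b)
    project ε = ε
    project {a} {b} (_◅_ {j = c} t rest) with φ a ≟ᶠ φ c
    ... | yes same   = subst (λ x → Reach C̄ x (φ b)) (sym same) (project rest)
    ... | no  differ = crossing⇒kept (differ , a , c , refl , refl , t) ◅ project rest

    C̄-reaches : ∀ x → Reach C̄ (φ root) x
    C̄-reaches x with representative x
    ... | w , refl = project (T-reaches w)

    -- Crossings lead from the entry of a class strictly down T to the entry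
    -- of the next class, so a cycle in C̄ would give a cycle in T.
    crossing-descends : ∀ {a x e} → Crossing a x → Entry a e → ∃ λ e′ → Entry x e′ × Path T e e′
    crossing-descends (a≢x , u , v , refl , refl , t) E with entry-above u
    ... | e₀ , E₀ , down = v , (refl , inj₂ (u , t , a≢x)) , (subst (λ y → Reach T y u) (entry-unique E₀ E) down ◅◅ʳ t)

    path-descends : ∀ {a x e} → Path C̄ a x → Entry a e → ∃ λ e′ → Entry x e′ × Path T e e′
    path-descends [ k ] E = crossing-descends (kept⇒crossing k) E
    path-descends (k ∷ ks) E with crossing-descends (kept⇒crossing k) E
    ... | _ , E′ , p with path-descends ks E′
    ... | e″ , E″ , p′ = e″ , E″ , p ++⁺ p′

    C̄-acyclic : Acyclic C̄
    C̄-acyclic a cycle with representative a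
    ... | w , refl with entry-above w
    ... | e , E , _ with path-descends cycle E
    ... | e′ , E′ , p = T-acyclic e (subst (Path T e) (sym (entry-unique E E′)) p)

    leaf-class-parent : ∀ {b u} → IsLeaf N u → Edge C b (φ u) → ∃ λ p → φ p ≡ b × Edge N p u
    leaf-class-parent {b} {u} leaf e with to (edges b (φ u)) e
    ... | _ , p , v , p∈b , v∈u , ep = p , p∈b , subst (Edge N p) (leaf-class-singleton leaf v∈u) ep

    -- A leaf of C is not the root class, so it keeps its in-edge in C̄.
    C-leaf⇒C̄-leaf : ∀ x → IsLeaf C x → IsLeaf C̄ x
    C-leaf⇒C̄-leaf x (in1 , out0) =
      C̄-nonroot-indeg x x≢root ,
      DC̄.outdeg≡0 (λ y k → DC.childless out0 (crossing⇒edge (kept⇒crossing k)))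
      where
      x≢root : x ≢ φ root
      x≢root refl = 0≢1+n (trans (sym root-class-indeg) in1)

    -- The class of a leaf u of N is {u}; it is not the root class and it is
    -- a leaf of C, whose only in-neighbour is the class of u's parent.
    leaf-class-is-leaf : ∀ {u} → IsLeaf N u → IsLeaf C (φ u)
    leaf-class-is-leaf {u} leaf@(N-in1 , N-out0) with crossing-into (φ u) u∉root
      where
      u∉root : φ u ≢ φ root
      u∉root same = 0≢1+n (trans (sym root-indeg)
                      (subst (λ z → indeg N z ≡ 1) (sym (leaf-class-singleton leaf (sym same))) N-in1))
    ... | a , c = DC.indeg≡1 (crossing⇒edge c) same-parent-class , DC.outdeg≡0 no-child
      where
      same-parent-class : ∀ b → Edge C b (φ u) → b ≡ a
      same-parent-class b e =
        let (p , p∈b , ep) = leaf-class-parent leaf e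
            (q , q∈a , eq) = leaf-class-parent leaf (crossing⇒edge c)
        in trans (sym p∈b) (trans (cong φ (DN.unique-parent N-in1 ep eq)) q∈a)

      no-child : ∀ y → ¬ Edge C (φ u) y
      no-child y e with to (edges (φ u) y) e
      ... | _ , p , v , p∈u , _ , ep = DN.childless N-out0 (subst (λ z → Edge N z v) (leaf-class-singleton leaf p∈u) ep)

    -- A non-leaf class has a crossing out of it, hence a C̄-child; so a leaf
    -- of C̄ is the class of a leaf of N.
    C̄-leaf⇒C-leaf : ∀ x → IsLeaf C̄ x → IsLeaf C x
    C̄-leaf⇒C-leaf x (_ , out0) with representative x
    ... | u , refl with isLeaf? N u
    ... | yes leaf = leaf-class-is-leaf leaf
    ... | no ¬leaf =
          let (w , w′ , w∈u , w′∉u , t) = class-exit ¬leaf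
          in ⊥-elim (DC̄.childless out0 (crossing⇒kept ((λ same → w′∉u (sym same)) , w , w′ , w∈u , refl , t)))

-- The theorem.

proposition3p3 : (N : Graph) (k : ℕ) → IsRPN N k → TreeBased N →
                 (C : Graph) (φ : Node N → Node C) → IsCompression N C φ →
                 TreeBased C
proposition3p3 N k rpn (S , S-reticulate , _ , (T-acyclic , r , _ , T-nonroot , T-reaches) , T-leaves) C φ compression =
  S̄ , S̄-reticulate , S̄-count ,
  (C̄-acyclic , φ root , C̄-root-indeg , C̄-nonroot-indeg , C̄-reaches) ,
  (λ x → mk⇔ (C̄-leaf⇒C-leaf x) (C-leaf⇒C̄-leaf x))
  where
  open IsRPN rpn using (root)
  open SpanningTree N rpn S S-reticulate T-acyclic r T-nonroot T-reaches T-leaves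
  open Classes C φ compression
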